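{- Let $H$ and $G$ be graphs with edges colored by $\{1,\ldots,k\}$ and let $h\ge 0$ be an integer. Let $\phi:V(H)\to V(G)$ be a homomorphism and let $G'$ be an $h$-th augmentation of $G$. Then there exists a graph $H'$ obtained from an $h$-th augmentation of $H$ by recoloring zeros, such that for every edge $(u,v)\in E(H')$: (i) if $\phi(u)\ne\phi(v)$, then $(\phi(u),\phi(v))\in E(G')$ and $(u,v)$ has the same color as $(\phi(u),\phi(v))$; and (ii) if $\phi(u)=\phi(v)$, then the color of $(u,v)$ is $0$.
   Context: Graphs are simple with arbitrary edge colorings; directed graphs have no loops, parallel edges, or oppositely directed pairs. For edge-colored undirected graphs, a homomorphism $\phi:V(H)\to V(G)$ maps every edge $uv$ of $H$ to an edge $\phi(u)\phi(v)$ of $G$ of the same color. Two vertices of a directed graph form a fork if they are distinct, non-adjacent, and have a common out-neighbor. A fraternal augmentation of a directed graph adds, for each fork $\{u,v\}$, one of the edges $(u,v)$, $(v,u)$. A $t$-th augmentation of an undirected graph $F$ is obtained from an orientation of $F$ by iterating fraternal augmentation $t$ times. If $F$ has edges colored by $\{1,\ldots,k\}$, an edge $(u,v)$ of a $t$-th augmentation of $F$ gets the color of $uv$ if $uv\in E(F)$, and color $0$ otherwise. For directed graphs $F',F''$ with edges colored by $\{0,1,\ldots,k\}$, $F''$ is obtained from $F'$ by recoloring zeros if $F'$ and $F''$ differ only in the colors of edges whose color in $F'$ is $0$. -}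

module Defs where

open import Data.Nat using (ℕ; zero; suc; _≤_)
open import Data.Fin using (Fin)
open import Data.Bool using (Bool; true; false; T)
open import Data.Maybe using (Maybe; just; nothing; Is-just)
open import Data.Product using (Σ; ∃; _×_; _,_)
open import Data.Sum using (_⊎_)
open import Relation.Nullary using (¬_)
open import Relation.Binary.PropositionalEquality using (_≡_; _≢_)

-- Finite simple undirected graph on vertex set Fin n with edges colored by {1,…,k}.
-- E u v ≡ just c  means  uv is an edge of color c;  E u v ≡ nothing  means non-edge.
record UGraph (n k : ℕ) : Set where
  field
    E      : Fin n → Fin n → Maybe ℕ
    sym    : ∀ u v → E u v ≡ E v u
    irrefl : ∀ v → E v v ≡ nothing
    colOK  : ∀ u v c → E u v ≡ just c → 1 ≤ c × c ≤ k
open UGraph public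

IsHom : ∀ {m n k} → UGraph m k → UGraph n k → (Fin m → Fin n) → Set
IsHom H G φ = ∀ u v c → E H u v ≡ just c → E G (φ u) (φ v) ≡ just c

Digraph : ℕ → Set
Digraph n = Fin n → Fin n → Bool

IsDigraph : ∀ {n} → Digraph n → Set
IsDigraph D = (∀ v → ¬ T (D v v)) × (∀ u v → ¬ (T (D u v) × T (D v u)))

IsOrientation : ∀ {n k} → UGraph n k → Digraph n → Set
IsOrientation F D =
  IsDigraph D
  × (∀ u v → T (D u v) → Is-just (E F u v))
  × (∀ u v → Is-just (E F u v) → T (D u v) ⊎ T (D v u))

Fork : ∀ {n} → Digraph n → Fin n → Fin n → Set
Fork D u v = u ≢ v × ¬ T (D u v) × ¬ T (D v u)
             × ∃ λ w → T (D u w) × T (D v w)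

IsFratAug : ∀ {n} → Digraph n → Digraph n → Set
IsFratAug D D' =
  IsDigraph D'
  × (∀ u v → T (D u v) → T (D' u v))
  × (∀ u v → Fork D u v → T (D' u v) ⊎ T (D' v u))
  × (∀ u v → T (D' u v) → T (D u v) ⊎ Fork D u v)

data Iter {n : ℕ} : ℕ → Digraph n → Digraph n → Set where
  base : ∀ {D} → Iter zero D D
  step : ∀ {t D D₁ D₂} → Iter t D D₁ → IsFratAug D₁ D₂ → Iter (suc t) D D₂

IsAugmentation : ∀ {n k} → ℕ → UGraph n k → Digraph n → Set
IsAugmentation t F D = Σ (Digraph _) λ D₀ → IsOrientation F D₀ × Iter t D₀ D

augCol : ∀ {n k} → UGraph n k → Fin n → Fin n → ℕ
augCol F u v with E F u v
... | just c  = c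
... | nothing = 0

RecolorZeros : ∀ {n} → ℕ → Digraph n → (Fin n → Fin n → ℕ) → (Fin n → Fin n → ℕ) → Set
RecolorZeros k D c c' =
  ∀ u v → T (D u v) → c' u v ≤ k × (c u v ≢ 0 → c' u v ≡ c u v)

-- Pull everything back along φ.  Orient an edge uv of H as the edge φ(u)φ(v) of G is
-- oriented.  At each augmentation step, a fork {u,v} of the current H_t with φ u ≠ φ v
-- is oriented as φ(u)φ(v) in G_{t+1}: by the invariant that every edge of H_t with
-- distinct endpoint images maps to an edge of G_t, the images of a fork form a fork of
-- G_t or are already adjacent, so they are adjacent in G_{t+1}.  Forks with φ u ≡ φ v
-- are oriented by vertex index.  Coloring every edge uv of the result by the augmented
-- color of φ(u)φ(v) then only recolors zeros, because φ is a homomorphism.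
module Submission where

open import Defs
open import Data.Nat using (ℕ; z≤n; _≤_; _<_)
open import Data.Nat.Properties using (_<?_; <-asym; <-cmp)
open import Data.Fin using (Fin; toℕ; _≟_)
open import Data.Fin.Properties using (any?; toℕ-injective)
open import Data.Bool using (T)
open import Data.Product using (Σ; _×_; _,_; proj₁; proj₂)
open import Data.Sum using (_⊎_; inj₁; inj₂; map₂)
open import Data.Maybe using (Maybe; just; nothing; Is-just)
import Data.Maybe.Relation.Unary.Any as Any
open import Data.Unit using (tt)
open import Data.Empty using (⊥-elim)
open import Relation.Nullary using (¬_; Dec; yes; no; ¬?)
open import Relation.Nullary.Decidable using (⌊_⌋; toWitness; fromWitness; _×-dec_; _⊎-dec_; T?)
open import Relation.Binary using (tri<; tri≈; tri>)
open import Relation.Binary.PropositionalEquality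
  using (_≡_; _≢_; refl; trans; subst; ≢-sym) renaming (sym to ≡-sym)

Is-just⇒≡just : {x : Maybe ℕ} → Is-just x → Σ ℕ λ c → x ≡ just c
Is-just⇒≡just (Any.just _) = _ , refl

≡just⇒Is-just : {x : Maybe ℕ} {c : ℕ} → x ≡ just c → Is-just x
≡just⇒Is-just refl = Any.just tt

module _ {n} {P : Fin n → Fin n → Set} (P? : ∀ u v → Dec (P u v)) where

  digraphOf : Digraph n
  digraphOf u v = ⌊ P? u v ⌋

  digraphOf-sound : ∀ {u v} → T (digraphOf u v) → P u v
  digraphOf-sound {u} {v} = toWitness {a? = P? u v}

  digraphOf-complete : ∀ {u v} → P u v → T (digraphOf u v)
  digraphOf-complete {u} {v} = fromWitness {a? = P? u v}

fork? : ∀ {n} (D : Digraph n) u v → Dec (Fork D u v)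
fork? D u v = ¬? (u ≟ v) ×-dec ¬? (T? (D u v)) ×-dec ¬? (T? (D v u))
              ×-dec any? (λ w → T? (D u w) ×-dec T? (D v w))

Fork-sym : ∀ {n} {D : Digraph n} {u v} → Fork D u v → Fork D v u
Fork-sym (u≢v , ¬uv , ¬vu , w , uw , vw) = ≢-sym u≢v , ¬vu , ¬uv , w , vw , uw

module _ {m n} (φ : Fin m → Fin n) where

  Respects : Digraph m → Digraph n → Set
  Respects H D = ∀ u v → T (H u v) → φ u ≢ φ v → T (D (φ u) (φ v))

  fork-image-adjacent : ∀ {H D D'} → Respects H D → IsFratAug D D' →
                        ∀ {u v} → Fork H u v → φ u ≢ φ v →
                        T (D' (φ u) (φ v)) ⊎ T (D' (φ v) (φ u))
  fork-image-adjacent {D = D} resp (_ , D⊆D' , forks , _) {u} {v} (_ , _ , _ , w , uw , vw) φu≢φv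
    with φ u ≟ φ w | φ v ≟ φ w
  ... | yes φu≡φw | yes φv≡φw = ⊥-elim (φu≢φv (trans φu≡φw (≡-sym φv≡φw)))
  ... | yes φu≡φw | no φv≢φw =
    inj₂ (D⊆D' _ _ (subst (λ z → T (D (φ v) z)) (≡-sym φu≡φw) (resp v w vw φv≢φw)))
  ... | no φu≢φw | yes φv≡φw =
    inj₁ (D⊆D' _ _ (subst (λ z → T (D (φ u) z)) (≡-sym φv≡φw) (resp u w uw φu≢φw)))
  ... | no φu≢φw | no φv≢φw with T? (D (φ u) (φ v)) | T? (D (φ v) (φ u))
  ...   | yes d | _     = inj₁ (D⊆D' _ _ d)
  ...   | no _  | yes d = inj₂ (D⊆D' _ _ d)
  ...   | no ¬d | no ¬d' =
    forks _ _ (φu≢φv , ¬d , ¬d' , φ w , resp u w uw φu≢φw , resp v w vw φv≢φw)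

  ForkDirection : Digraph n → Fin m → Fin m → Set
  ForkDirection D' u v = (φ u ≡ φ v × toℕ u < toℕ v) ⊎ (φ u ≢ φ v × T (D' (φ u) (φ v)))

  forkDirection? : ∀ D' u v → Dec (ForkDirection D' u v)
  forkDirection? D' u v = ((φ u ≟ φ v) ×-dec (toℕ u <? toℕ v))
                          ⊎-dec (¬? (φ u ≟ φ v) ×-dec T? (D' (φ u) (φ v)))

  forkDirection-asym : ∀ {D'} → IsDigraph D' → ∀ {u v} →
                       ForkDirection D' u v → ¬ ForkDirection D' v u
  forkDirection-asym _ (inj₁ (_ , u<v)) (inj₁ (_ , v<u)) = <-asym u<v v<u
  forkDirection-asym _ (inj₁ (φu≡φv , _)) (inj₂ (φv≢φu , _)) = φv≢φu (≡-sym φu≡φv)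
  forkDirection-asym _ (inj₂ (φu≢φv , _)) (inj₁ (φv≡φu , _)) = φu≢φv (≡-sym φv≡φu)
  forkDirection-asym (_ , antisym) (inj₂ (_ , uv)) (inj₂ (_ , vu)) = antisym _ _ (uv , vu)

  PullbackAugEdge : Digraph m → Digraph n → Fin m → Fin m → Set
  PullbackAugEdge H D' u v = T (H u v) ⊎ (Fork H u v × ForkDirection D' u v)

  pullbackAugEdge? : ∀ H D' u v → Dec (PullbackAugEdge H D' u v)
  pullbackAugEdge? H D' u v = T? (H u v) ⊎-dec (fork? H u v ×-dec forkDirection? D' u v)

  pullbackAug : Digraph m → Digraph n → Digraph m
  pullbackAug H D' = digraphOf (pullbackAugEdge? H D')

  module _ {H : Digraph m} {D' : Digraph n} where

    pullbackAug-sound : ∀ {u v} → T (pullbackAug H D' u v) → PullbackAugEdge H D' u v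
    pullbackAug-sound = digraphOf-sound (pullbackAugEdge? H D')

    pullbackAug-complete : ∀ {u v} → PullbackAugEdge H D' u v → T (pullbackAug H D' u v)
    pullbackAug-complete = digraphOf-complete (pullbackAugEdge? H D')

    pullbackAug-isDigraph : IsDigraph H → IsDigraph D' → IsDigraph (pullbackAug H D')
    pullbackAug-isDigraph (H-loopless , H-antisym) D'-digraph = loopless , antisym
      where
      loopless : ∀ v → ¬ T (pullbackAug H D' v v)
      loopless v vv with pullbackAug-sound vv
      ... | inj₁ h = H-loopless v h
      ... | inj₂ ((v≢v , _) , _) = v≢v refl
      antisym : ∀ u v → ¬ (T (pullbackAug H D' u v) × T (pullbackAug H D' v u))
      antisym u v (uv , vu) with pullbackAug-sound uv | pullbackAug-sound vu
      ... | inj₁ h | inj₁ h' = H-antisym u v (h , h')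
      ... | inj₁ h | inj₂ ((_ , _ , ¬h , _) , _) = ¬h h
      ... | inj₂ ((_ , _ , ¬h , _) , _) | inj₁ h = ¬h h
      ... | inj₂ (_ , dir) | inj₂ (_ , dir') = forkDirection-asym D'-digraph dir dir'

    pullbackAug-isFratAug : ∀ {D} → IsDigraph H → Respects H D → IsFratAug D D' →
                            IsFratAug H (pullbackAug H D')
    pullbackAug-isFratAug H-digraph resp aug@(D'-digraph , _) =
      pullbackAug-isDigraph H-digraph D'-digraph ,
      (λ u v h → pullbackAug-complete (inj₁ h)) ,
      (λ u v fork → orient fork (φ u ≟ φ v)) ,
      (λ u v uv → map₂ proj₁ (pullbackAug-sound uv))
      where
      orient : ∀ {u v} → Fork H u v → Dec (φ u ≡ φ v) →
               T (pullbackAug H D' u v) ⊎ T (pullbackAug H D' v u)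
      orient fork (no φu≢φv) with fork-image-adjacent resp aug fork φu≢φv
      ... | inj₁ d = inj₁ (pullbackAug-complete (inj₂ (fork , inj₂ (φu≢φv , d))))
      ... | inj₂ d = inj₂ (pullbackAug-complete
                       (inj₂ (Fork-sym fork , inj₂ (≢-sym φu≢φv , d))))
      orient {u} {v} fork (yes φu≡φv) with <-cmp (toℕ u) (toℕ v)
      ... | tri< u<v _ _ = inj₁ (pullbackAug-complete (inj₂ (fork , inj₁ (φu≡φv , u<v))))
      ... | tri≈ _ u≡v _ = ⊥-elim (proj₁ fork (toℕ-injective u≡v))
      ... | tri> _ _ v<u = inj₂ (pullbackAug-complete
                              (inj₂ (Fork-sym fork , inj₁ (≡-sym φu≡φv , v<u))))

    pullbackAug-respects : ∀ {D} → Respects H D → IsFratAug D D' → Respects (pullbackAug H D') D'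
    pullbackAug-respects resp (_ , D⊆D' , _) u v uv φu≢φv with pullbackAug-sound uv
    ... | inj₁ h = D⊆D' _ _ (resp u v h φu≢φv)
    ... | inj₂ (_ , inj₁ (φu≡φv , _)) = ⊥-elim (φu≢φv φu≡φv)
    ... | inj₂ (_ , inj₂ (_ , d)) = d

  pullbackIter : ∀ {H₀ D₀ t Dₜ} → IsDigraph H₀ → Respects H₀ D₀ → Iter t D₀ Dₜ →
                 Σ (Digraph m) λ Hₜ → Iter t H₀ Hₜ × IsDigraph Hₜ × Respects Hₜ Dₜ
  pullbackIter H₀-digraph resp base = _ , base , H₀-digraph , resp
  pullbackIter H₀-digraph resp₀ (step {D₂ = D'} iter aug@(D'-digraph , _))
    with pullbackIter H₀-digraph resp₀ iter
  ... | Hₜ , iterH , Hₜ-digraph , resp =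
    pullbackAug Hₜ D' ,
    step iterH (pullbackAug-isFratAug Hₜ-digraph resp aug) ,
    pullbackAug-isDigraph Hₜ-digraph D'-digraph ,
    pullbackAug-respects resp aug

  module _ {k} (H : UGraph m k) (D₀ : Digraph n) where

    PullbackOrEdge : Fin m → Fin m → Set
    PullbackOrEdge u v = Is-just (E H u v) × T (D₀ (φ u) (φ v))

    pullbackOrEdge? : ∀ u v → Dec (PullbackOrEdge u v)
    pullbackOrEdge? u v = Any.dec (λ _ → yes tt) (E H u v) ×-dec T? (D₀ (φ u) (φ v))

    pullbackOrientation : Digraph m
    pullbackOrientation = digraphOf pullbackOrEdge?

    pullbackOrientation-image : ∀ {u v} → T (pullbackOrientation u v) → T (D₀ (φ u) (φ v))
    pullbackOrientation-image uv = proj₂ (digraphOf-sound pullbackOrEdge? uv)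

    pullbackOrientation-respects : Respects pullbackOrientation D₀
    pullbackOrientation-respects u v uv _ = pullbackOrientation-image uv

    pullbackOrientation-isOrientation : ∀ {G : UGraph n k} → IsHom H G φ → IsOrientation G D₀ →
                                        IsOrientation H pullbackOrientation
    pullbackOrientation-isOrientation hom ((D₀-loopless , D₀-antisym) , _ , covers) =
      ((λ v vv → D₀-loopless (φ v) (pullbackOrientation-image vv)) ,
       (λ u v (uv , vu) → D₀-antisym (φ u) (φ v)
                            (pullbackOrientation-image uv , pullbackOrientation-image vu))) ,
      (λ u v uv → proj₁ (digraphOf-sound pullbackOrEdge? uv)) ,
      orient
      where
      orient : ∀ u v → Is-just (E H u v) → T (pullbackOrientation u v) ⊎ T (pullbackOrientation v u)
      orient u v edge with Is-just⇒≡just edge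
      ... | c , uv≡c with covers (φ u) (φ v) (≡just⇒Is-just (hom u v c uv≡c))
      ...   | inj₁ d = inj₁ (digraphOf-complete pullbackOrEdge? (edge , d))
      ...   | inj₂ d = inj₂ (digraphOf-complete pullbackOrEdge?
                               (≡just⇒Is-just (trans (UGraph.sym H v u) uv≡c) , d))

  pullbackAugmentation : ∀ {k t} {H : UGraph m k} {G : UGraph n k} {G'} → IsHom H G φ →
                         IsAugmentation t G G' →
                         Σ (Digraph m) λ H' → IsAugmentation t H H' × Respects H' G'
  pullbackAugmentation {H = H} {G} hom (D₀ , D₀-orientation , iter) =
    let H₀-orientation = pullbackOrientation-isOrientation H D₀ {G} hom D₀-orientation
        H' , iterH , _ , resp =
          pullbackIter (proj₁ H₀-orientation) (pullbackOrientation-respects H D₀) iter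
    in H' , (pullbackOrientation H D₀ , H₀-orientation , iterH) , resp

module _ {n k} (G : UGraph n k) where

  augCol≤ : ∀ a b → augCol G a b ≤ k
  augCol≤ a b with E G a b in ab
  ... | just c  = proj₂ (colOK G a b c ab)
  ... | nothing = z≤n

  augCol-edge : ∀ {a b c} → E G a b ≡ just c → augCol G a b ≡ c
  augCol-edge ab rewrite ab = refl

  augCol-diagonal : ∀ a → augCol G a a ≡ 0
  augCol-diagonal a rewrite irrefl G a = refl

augCol-hom : ∀ {m n k} {H : UGraph m k} {G : UGraph n k} {φ} → IsHom H G φ →
             ∀ u v → augCol H u v ≢ 0 → augCol G (φ u) (φ v) ≡ augCol H u v
augCol-hom {H = H} {G} {φ} hom u v nonzero with E H u v in uv
... | just c  = augCol-edge G (hom u v c uv)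
... | nothing = ⊥-elim (nonzero refl)

lemma9 : ∀ {k m n} (H : UGraph m k) (G : UGraph n k) (h : ℕ) (φ : Fin m → Fin n)
         → IsHom H G φ
         → (G' : Digraph n) → IsAugmentation h G G'
         → Σ (Digraph m) λ H' → Σ (Fin m → Fin m → ℕ) λ cH'
             → IsAugmentation h H H'
             × RecolorZeros k H' (augCol H) cH'
             × (∀ u v → T (H' u v)
                  → (φ u ≢ φ v → T (G' (φ u) (φ v)) × cH' u v ≡ augCol G (φ u) (φ v))
                  × (φ u ≡ φ v → cH' u v ≡ 0))
lemma9 H G h φ hom G' augG with pullbackAugmentation φ {H = H} {G = G} hom augG
... | H' , augH , resp =
  H' , (λ u v → augCol G (φ u) (φ v)) , augH ,
  (λ u v _ → augCol≤ G (φ u) (φ v) , augCol-hom {H = H} {G} {φ} hom u v) ,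
  λ u v uv → (λ φu≢φv → resp u v uv φu≢φv , refl) ,
             (λ φu≡φv → subst (λ z → augCol G (φ u) z ≡ 0) φu≡φv (augCol-diagonal G (φ u)))
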